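{- Let $A$ be the vertex–arc incidence matrix of $G_d$ and let $\succ$ be the pure lexicographic order induced by the variable ordering $x_{i,j}\succ x_{k,l}$ iff $i<k$, or $i=k$ and $j>l$. Then the reduced Gröbner basis of $I_A$ with respect to $\succ$ is $\{x_{i,j}-x_{i,i+1}x_{i+1,i+2}\cdots x_{j-1,j}: i<j-1\}$. In particular it has $\binom d2-(d-1)$ elements.
   Context: $G_d$ has vertices $1,\dots,d$ and arcs $(i,j)$, $1\le i<j\le d$, directed from $i$ to $j$; $n=\binom d2$. Its vertex–arc incidence matrix $A$ has in the column of arc $(i,j)$ entry $1$ in row $i$, $-1$ in row $j$, $0$ elsewhere. $I_A=\langle\mathbf{x}^{\mathbf{u}}-\mathbf{x}^{\mathbf{v}}:A\mathbf{u}=A\mathbf{v},\ \mathbf{u},\mathbf{v}\in\mathbb{N}^n\rangle\subseteq k[x_{i,j}:1\le i<j\le d]$. -}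

module Defs where

open import Level using (Level; _⊔_; suc)
open import Algebra.Bundles using (CommutativeRing)
open import Data.Bool using (Bool; true; false; if_then_else_; _∧_)
open import Data.Nat as ℕ using (ℕ; zero; _≤ᵇ_; _≡ᵇ_; _∸_)
import Data.Nat.Properties as ℕP
open import Data.Integer as ℤ using (ℤ; +_)
open import Data.Fin as Fin using (Fin; toℕ)
import Data.Fin.Properties as FinP
open import Data.List using (List; []; _∷_; map; concatMap; foldr; length; lookup)
open import Data.Product using (Σ; ∃; ∃-syntax; _×_; _,_)
open import Data.Sum using (_⊎_)
open import Relation.Nullary using (¬_; Dec; yes; no)
open import Relation.Nullary.Decidable using (⌊_⌋; _→-dec_)
open import Relation.Binary.PropositionalEquality using (_≡_; _≢_)
open import Data.List.Membership.Propositional using (_∈_)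

record Field (c ℓ : Level) : Set (Level.suc (c ⊔ ℓ)) where
  field
    commutativeRing : CommutativeRing c ℓ
  open CommutativeRing commutativeRing public
  field
    1≉0     : ¬ (1# ≈ 0#)
    inverse : ∀ x → ¬ (x ≈ 0#) → ∃[ y ] (x * y ≈ 1#)

-- Monomials in the variables x_{i,j}, 0 ≤ i < j < d (vertices are
-- 0-indexed: Fin d stands for the vertices 1,…,d shifted by one).
-- A monomial is an exponent function; only entries with i < j are
-- meaningful, entries with ¬ (i < j) are ignored by every notion below.

Mon : ℕ → Set
Mon d = Fin d → Fin d → ℕ

_≈M_ : ∀ {d} → Mon d → Mon d → Set
_≈M_ {d} α β = ∀ (i j : Fin d) → i Fin.< j → α i j ≡ β i j

_≈M?_ : ∀ {d} (α β : Mon d) → Dec (α ≈M β)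
α ≈M? β = FinP.all? λ i → FinP.all? λ j → (i FinP.<? j) →-dec (α i j ℕP.≟ β i j)

_·M_ : ∀ {d} → Mon d → Mon d → Mon d
(α ·M β) i j = α i j ℕ.+ β i j

_∣M_ : ∀ {d} → Mon d → Mon d → Set
_∣M_ {d} α β = ∀ (i j : Fin d) → i Fin.< j → α i j ℕ.≤ β i j

VarGt : ∀ {d} → (Fin d × Fin d) → (Fin d × Fin d) → Set
VarGt (i , j) (k , l) = (i Fin.< k) ⊎ ((i ≡ k) × (l Fin.< j))

_≻_ : ∀ {d} → Mon d → Mon d → Set
_≻_ {d} α β =
  ∃[ i ] ∃[ j ] ((i Fin.< j) × (β i j ℕ.< α i j) ×
    (∀ (k l : Fin d) → k Fin.< l → VarGt (k , l) (i , j) → α k l ≡ β k l))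

-- Polynomials over a field, as finite lists of terms (coefficient,
-- monomial); their meaning is the coefficient function `coeff`.

module Poly {c ℓ} (K : Field c ℓ) (d : ℕ) where
  open Field K

  Pol : Set c
  Pol = List (Carrier × Mon d)

  coeff : Pol → Mon d → Carrier
  coeff []             α = 0#
  coeff ((a , β) ∷ f)  α = (if ⌊ β ≈M? α ⌋ then a else 0#) + coeff f α

  _≈P_ : Pol → Pol → Set ℓ
  f ≈P g = ∀ α → coeff f α ≈ coeff g α

  IsZero : Pol → Set ℓ
  IsZero f = ∀ α → coeff f α ≈ 0#

  _+P_ : Pol → Pol → Pol
  f +P g = Data.List._++_ f g

  _*P_ : Pol → Pol → Pol
  f *P g = concatMap (λ { (a , α) → map (λ { (b , β) → (a * b , α ·M β) }) g }) f

  0P : Pol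
  0P = []

  sumP : List Pol → Pol
  sumP = foldr _+P_ 0P

  binom : Mon d → Mon d → Pol
  binom u v = (1# , u) ∷ (- 1# , v) ∷ []

  LM : Pol → Mon d → Set ℓ
  LM f α = (¬ (coeff f α ≈ 0#)) ×
           (∀ β → ¬ (coeff f β ≈ 0#) → (β ≈M α) ⊎ (α ≻ β))

  -- G is a reduced Gröbner basis of the ideal with membership predicate I
  -- (Cox–Little–O'Shea, Def. 2.7.4 together with Def. 2.5.5).
  record IsReducedGB {p} (I : Pol → Set p) (G : List Pol) : Set (c ⊔ ℓ ⊔ p) where
    field
      ⊆I      : ∀ g → g ∈ G → I g
      monic   : ∀ g → g ∈ G → ∃[ α ] (LM g α × (coeff g α ≈ 1#))
      -- ⟨LT(I)⟩ = ⟨LT(G)⟩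
      leading : ∀ f → I f → ¬ IsZero f → ∀ α → LM f α →
                ∃[ g ] ∃[ β ] ((g ∈ G) × LM g β × (β ∣M α))
      -- no monomial of g lies in ⟨LT(G ∖ {g})⟩
      reduced : ∀ (p q : Fin (length G)) → p ≢ q →
                ∀ β → LM (lookup G q) β →
                ∀ γ → ¬ (coeff (lookup G p) γ ≈ 0#) → ¬ (β ∣M γ)

incA : ∀ {d} → Fin d → Fin d → Fin d → ℤ
incA k i j = if ⌊ k Fin.≟ i ⌋ then + 1 else (if ⌊ k Fin.≟ j ⌋ then ℤ.- (+ 1) else + 0)

sumℤ : ∀ {m} → (Fin m → ℤ) → ℤ
sumℤ {zero}    f = + 0
sumℤ {ℕ.suc m} f = f Fin.zero ℤ.+ sumℤ (λ i → f (Fin.suc i))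

applyA : ∀ {d} → Mon d → Fin d → ℤ
applyA u k = sumℤ λ i → sumℤ λ j →
  if ⌊ i Fin.<? j ⌋ then incA k i j ℤ.* (+ u i j) else + 0

module Toric {c ℓ} (K : Field c ℓ) (d : ℕ) where
  open Field K
  open Poly K d

  Gen : Set
  Gen = Σ (Mon d) λ u → Σ (Mon d) λ v → ∀ k → applyA u k ≡ applyA v k

  InIA : Pol → Set (c ⊔ ℓ)
  InIA f = Σ (List (Pol × Gen)) λ hs → (f ≈P sumP (map (λ { (h , u , v , _) → h *P binom u v }) hs))

  varMon : Fin d → Fin d → Mon d
  varMon i j k l = if ⌊ k Fin.≟ i ⌋ ∧ ⌊ l Fin.≟ j ⌋ then 1 else 0

  -- x_{i,i+1} x_{i+1,i+2} ⋯ x_{j-1,j}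
  pathMon : Fin d → Fin d → Mon d
  pathMon i j k l =
    if (toℕ i ≤ᵇ toℕ k) ∧ (ℕ.suc (toℕ k) ≡ᵇ toℕ l) ∧ (toℕ l ≤ᵇ toℕ j) then 1 else 0

  pathBinom : Fin d → Fin d → Pol
  pathBinom i j = binom (varMon i j) (pathMon i j)

module Submission where

-- For j > i+1, x_{i,j} − x_{i,i+1} ⋯ x_{j−1,j} lies in I_A because the columns
-- e_k − e_{k+1} of A telescope to e_i − e_j, and its leading monomial is x_{i,j},
-- which is lex-above every x_{k,k+1} with i ≤ k < j.
--
-- A monomial α in the adjacent variables x_{i,i+1} alone is the ≻-least monomial
-- of its fibre {δ : A δ = A α}: if α ≻ δ, their first difference is at some
-- x_{i,i+1}, and they agree on the other arcs at vertex i, which all lie ≻-above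
-- it, so (A δ)_i < (A α)_i.  Summing coefficients over a fibre kills every
-- h (x^u − x^v) with A u = A v, hence such an α is never the leading monomial of
-- an element of I_A: every leading monomial is divisible by a non-adjacent
-- x_{i,j}.  Reducedness holds because the monomials that occur are the
-- non-adjacent variables and products of adjacent ones.

open import Defs
open import Level using (Level)
import Algebra.Properties.CommutativeSemigroup as CommutativeSemigroupProperties
import Algebra.Solver.CommutativeMonoid as CommutativeMonoidSolver
open import Data.Bool using (true; false; if_then_else_)
open import Data.Empty using (⊥-elim)
open import Data.Fin as Fin using (Fin; toℕ; zero; suc)
import Data.Fin.Properties as FinP
open import Data.Integer as ℤ using (ℤ; +_)
import Data.Integer.Properties as ℤP
open import Data.List using (List; []; _∷_; map; _++_; length; lookup; allFin)
open import Data.List.Membership.Propositional using (_∈_)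
open import Data.List.Membership.Propositional.Properties
  using (∈-map⁺; ∈-map⁻; ∈-++⁺ˡ; ∈-++⁺ʳ; ∈-allFin; ∈-lookup)
open import Data.List.Properties using (length-++; length-map; length-tabulate)
open import Data.List.Relation.Binary.Disjoint.Propositional using (Disjoint)
open import Data.List.Relation.Unary.All as All using (All; []; _∷_)
import Data.List.Relation.Unary.All.Properties as All
open import Data.List.Relation.Unary.AllPairs as AllPairs using (AllPairs; []; _∷_)
open import Data.List.Relation.Unary.Unique.Propositional using (Unique)
import Data.List.Relation.Unary.Unique.Propositional.Properties as Unique
open import Data.Nat as ℕ using (ℕ; zero; suc; _∸_; _<_; _≤_; _≤′_; ≤′-refl; ≤′-step; z≤n; s≤s)
open import Data.Nat.Combinatorics using (_C_; nC1≡n; nCk+nC[k+1]≡[n+1]C[k+1])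
import Data.Nat.Properties as ℕP
open import Data.Product as Product using (Σ; ∃-syntax; _×_; _,_; proj₁; proj₂; uncurry)
open import Data.Product.Properties using (,-injective; ,-injectiveʳ)
open import Data.Sum as Sum using (_⊎_; inj₁; inj₂)
open import Effect.Monad using (RawMonad)
open import Function using (_∘_)
open import Relation.Binary.Core using (Rel)
open import Relation.Binary.Definitions using (_Respects_; tri<; tri≈; tri>)
open import Relation.Binary.PropositionalEquality as ≡
  using (_≡_; _≢_; refl; sym; trans; cong; cong₂; subst; subst₂)
import Relation.Binary.Reasoning.Setoid as ≈-Reasoning
open import Relation.Nullary using (¬_; Dec; yes; no; does)
open import Relation.Nullary.Decidable using (⌊_⌋; _×-dec_; ¬?; dec-true; dec-false)
open import Relation.Nullary.Negation using (DoubleNegation; ¬¬-map; ¬¬-Monad)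
open import Relation.Unary using (Decidable)

AllPairs-map⁺-within : ∀ {a b p r s} {A : Set a} {B : Set b} {P : A → Set p}
                         {R : Rel A r} {S : Rel B s} {f : A → B} →
                       (∀ {x y} → P x → P y → R x y → S (f x) (f y)) →
                       ∀ {xs} → All P xs → AllPairs R xs → AllPairs S (map f xs)
AllPairs-map⁺-within f⁺ []         []         = []
AllPairs-map⁺-within f⁺ (px ∷ pxs) (rx ∷ rxs) =
  All.map⁺ (All.zipWith (λ (py , rxy) → f⁺ px py rxy) (pxs , rx)) ∷ AllPairs-map⁺-within f⁺ pxs rxs

lookup-injective : ∀ {a} {A : Set a} {xs : List A} → Unique xs →
                   ∀ {p q} → lookup xs p ≡ lookup xs q → p ≡ q
lookup-injective (_ ∷ _)    {zero}  {zero}  _  = refl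
lookup-injective (x∉xs ∷ _) {zero}  {suc q} eq = ⊥-elim (All.lookup x∉xs (∈-lookup q) eq)
lookup-injective (x∉xs ∷ _) {suc p} {zero}  eq = ⊥-elim (All.lookup x∉xs (∈-lookup p) (sym eq))
lookup-injective (_ ∷ xs!)  {suc p} {suc q} eq = cong suc (lookup-injective xs! eq)

sumℤ-cong : ∀ {m} {f g : Fin m → ℤ} → (∀ i → f i ≡ g i) → sumℤ f ≡ sumℤ g
sumℤ-cong {zero}  _   = refl
sumℤ-cong {suc m} f≗g = cong₂ ℤ._+_ (f≗g zero) (sumℤ-cong (f≗g ∘ suc))

sumℤ-+ : ∀ {m} (f g : Fin m → ℤ) → sumℤ (λ i → f i ℤ.+ g i) ≡ sumℤ f ℤ.+ sumℤ g
sumℤ-+ {zero}  f g = refl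
sumℤ-+ {suc m} f g =
  trans (cong (ℤ._+_ (f zero ℤ.+ g zero)) (sumℤ-+ (f ∘ suc) (g ∘ suc)))
        (interchange (f zero) (g zero) (sumℤ (f ∘ suc)) (sumℤ (g ∘ suc)))
  where open CommutativeSemigroupProperties ℤP.+-commutativeSemigroup using (interchange)

sumℤ-zero : ∀ {m} (f : Fin m → ℤ) → (∀ i → f i ≡ + 0) → sumℤ f ≡ + 0
sumℤ-zero {zero}  f _   = refl
sumℤ-zero {suc m} f f≗0 = cong₂ ℤ._+_ (f≗0 zero) (sumℤ-zero (f ∘ suc) (f≗0 ∘ suc))

sumℤ-single : ∀ {m} (f : Fin m → ℤ) p → (∀ q → q ≢ p → f q ≡ + 0) → sumℤ f ≡ f p
sumℤ-single {suc m} f zero    f≗0 =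
  trans (cong (ℤ._+_ (f zero)) (sumℤ-zero (f ∘ suc) λ q → f≗0 (suc q) λ ())) (ℤP.+-identityʳ (f zero))
sumℤ-single {suc m} f (suc p) f≗0 =
  trans (cong₂ ℤ._+_ (f≗0 zero λ ())
                     (sumℤ-single (f ∘ suc) p λ q q≢p → f≗0 (suc q) (q≢p ∘ FinP.suc-injective)))
        (ℤP.+-identityˡ (f (suc p)))

sumℤ-< : ∀ {m} (f g : Fin m → ℤ) p → f p ℤ.< g p → (∀ q → q ≢ p → f q ≡ g q) →
         sumℤ f ℤ.< sumℤ g
sumℤ-< {suc m} f g zero    f<g f≗g =
  subst (λ s → f zero ℤ.+ s ℤ.< g zero ℤ.+ sumℤ (g ∘ suc))
        (sym (sumℤ-cong λ q → f≗g (suc q) λ ()))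
        (ℤP.+-monoˡ-< (sumℤ (g ∘ suc)) f<g)
sumℤ-< {suc m} f g (suc p) f<g f≗g =
  subst (λ x → x ℤ.+ sumℤ (f ∘ suc) ℤ.< g zero ℤ.+ sumℤ (g ∘ suc))
        (sym (f≗g zero λ ()))
        (ℤP.+-monoʳ-< (g zero)
          (sumℤ-< (f ∘ suc) (g ∘ suc) p f<g λ q q≢p → f≗g (suc q) (q≢p ∘ FinP.suc-injective)))

module _ {d : ℕ} where

  -- Monomials and the lexicographic order

  ≈M-sym : ∀ {α β : Mon d} → α ≈M β → β ≈M α
  ≈M-sym α≈β i j i<j = sym (α≈β i j i<j)

  ≈M-trans : ∀ {α β γ : Mon d} → α ≈M β → β ≈M γ → α ≈M γ
  ≈M-trans α≈β β≈γ i j i<j = trans (α≈β i j i<j) (β≈γ i j i<j)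

  ≻⇒≉M : ∀ {α β : Mon d} → α ≻ β → ¬ (β ≈M α)
  ≻⇒≉M (i , j , i<j , β<α , _) β≈α = ℕP.<-irrefl (β≈α i j i<j) β<α

  ≻-respʳ : ∀ {α β γ : Mon d} → α ≻ β → β ≈M γ → α ≻ γ
  ≻-respʳ {α} (i , j , i<j , β<α , above) β≈γ =
    i , j , i<j , subst (_< α i j) (β≈γ i j i<j) β<α ,
    λ k l k<l kl≻ij → trans (above k l k<l kl≻ij) (β≈γ k l k<l)

  ≻-asym : ∀ {α β : Mon d} → α ≻ β → ¬ (β ≻ α)
  ≻-asym (i , j , i<j , β<α , above) (k , l , k<l , α<β , above′) with FinP.<-cmp i k
  ... | tri< i<k _ _ = ℕP.<-irrefl (above′ i j i<j (inj₁ i<k)) β<α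
  ... | tri> _ _ k<i = ℕP.<-irrefl (above k l k<l (inj₁ k<i)) α<β
  ... | tri≈ _ refl _ with FinP.<-cmp j l
  ...   | tri< j<l _ _  = ℕP.<-irrefl (above k l k<l (inj₂ (refl , j<l))) α<β
  ...   | tri> _ _ l<j  = ℕP.<-irrefl (above′ i j i<j (inj₂ (refl , l<j))) β<α
  ...   | tri≈ _ refl _ = ℕP.<-asym β<α α<β

  NonAdjacent : Fin d → Fin d → Set
  NonAdjacent i j = suc (toℕ i) < toℕ j

  NonAdjacent⇒< : ∀ {i j} → NonAdjacent i j → i Fin.< j
  NonAdjacent⇒< = ℕP.<-trans (ℕP.n<1+n _)

  Standard : Mon d → Set
  Standard α = ∀ i j → NonAdjacent i j → α i j ≡ 0

  standard-or-nonAdjacentFactor : ∀ α → Standard α ⊎ ∃[ i ] ∃[ j ] (NonAdjacent i j × 0 < α i j)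
  standard-or-nonAdjacentFactor α
    with FinP.any? (λ i → FinP.any? λ j → (suc (toℕ i) ℕP.<? toℕ j) ×-dec (0 ℕP.<? α i j))
  ... | yes (i , j , factor) = inj₂ (i , j , factor)
  ... | no ¬factor           =
    inj₁ λ i j i≁j → ℕP.n≤0⇒n≡0 (ℕP.≮⇒≥ λ pos → ¬factor (i , j , i≁j , pos))

  -- The degree map α ↦ A α

  SameDegree : Mon d → Mon d → Set
  SameDegree α β = ∀ k → applyA α k ≡ applyA β k

  sameDegree? : ∀ α β → Dec (SameDegree α β)
  sameDegree? α β = FinP.all? λ k → applyA α k ℤP.≟ applyA β k

  -- applyA α k unfolds to sumℤ λ i → sumℤ λ j → contribution α k i j.
  contribution : Mon d → Fin d → Fin d → Fin d → ℤ
  contribution α k i j = if ⌊ i Fin.<? j ⌋ then incA k i j ℤ.* + α i j else + 0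

  contribution-cong : ∀ {α β : Mon d} {k i j} → (i Fin.< j → incA k i j ≡ + 0 ⊎ α i j ≡ β i j) →
                      contribution α k i j ≡ contribution β k i j
  contribution-cong {α} {β} {k} {i} {j} agree with i Fin.<? j
  ... | no _    = refl
  ... | yes i<j with agree i<j
  ...   | inj₁ Aki≡0 rewrite Aki≡0 = trans (ℤP.*-zeroˡ (+ α i j)) (sym (ℤP.*-zeroˡ (+ β i j)))
  ...   | inj₂ α≡β   rewrite α≡β   = refl

  contribution-zero : ∀ {α : Mon d} {k i j} → α i j ≡ 0 → contribution α k i j ≡ + 0
  contribution-zero {α} {k} {i} {j} α≡0 with i Fin.<? j
  ... | no _              = refl
  ... | yes _ rewrite α≡0 = ℤP.*-zeroʳ (incA k i j)

  contribution-· : ∀ (α β : Mon d) k i j →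
                   contribution (α ·M β) k i j ≡ contribution α k i j ℤ.+ contribution β k i j
  contribution-· α β k i j with i Fin.<? j
  ... | no _  = refl
  ... | yes _ = trans (cong (incA k i j ℤ.*_) (ℤP.pos-+ (α i j) (β i j))) (ℤP.*-distribˡ-+ (incA k i j) _ _)

  applyA-cong : ∀ {α β : Mon d} → α ≈M β → SameDegree α β
  applyA-cong {α} {β} α≈β k =
    sumℤ-cong λ i → sumℤ-cong λ j → contribution-cong {α} {β} {k} (inj₂ ∘ α≈β i j)

  applyA-· : ∀ (α β : Mon d) k → applyA (α ·M β) k ≡ applyA α k ℤ.+ applyA β k
  applyA-· α β k =
    trans (sumℤ-cong λ i → trans (sumℤ-cong (contribution-· α β k i))
                                 (sumℤ-+ (contribution α k i) (contribution β k i)))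
          (sumℤ-+ (λ i → sumℤ (contribution α k i)) (λ i → sumℤ (contribution β k i)))

  applyA-zero : ∀ {α : Mon d} → (∀ i j → α i j ≡ 0) → ∀ k → applyA α k ≡ + 0
  applyA-zero {α} α≡0 k =
    sumℤ-zero _ λ i → sumℤ-zero (contribution α k i) λ j → contribution-zero {α} {k} (α≡0 i j)

  SameDegree-·ˡ : ∀ {u v : Mon d} α → SameDegree u v → SameDegree (α ·M u) (α ·M v)
  SameDegree-·ˡ {u} {v} α u~v k =
    trans (applyA-· α u k) (trans (cong (ℤ._+_ (applyA α k)) (u~v k)) (sym (applyA-· α v k)))

  basis : Fin d → Fin d → ℤ
  basis i k = if ⌊ k Fin.≟ i ⌋ then + 1 else + 0

  incA-basis : ∀ {i j k : Fin d} → i ≢ j → incA k i j ≡ basis i k ℤ.- basis j k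
  incA-basis {i} {j} {k} i≢j with k Fin.≟ i | k Fin.≟ j
  ... | yes refl | yes refl = ⊥-elim (i≢j refl)
  ... | yes _    | no _     = refl
  ... | no _     | yes _    = refl
  ... | no _     | no _     = refl

  incA-source : ∀ (i j : Fin d) → incA i i j ≡ + 1
  incA-source i j with i Fin.≟ i
  ... | yes _  = refl
  ... | no i≢i = ⊥-elim (i≢i refl)

  incA-elsewhere : ∀ {k i j : Fin d} → k ≢ i → k ≢ j → incA k i j ≡ + 0
  incA-elsewhere {k} {i} {j} k≢i k≢j with k Fin.≟ i | k Fin.≟ j
  ... | yes k≡i | _       = ⊥-elim (k≢i k≡i)
  ... | no _    | yes k≡j = ⊥-elim (k≢j k≡j)
  ... | no _    | no _    = refl

  -- Row i of A only sees the arcs entering or leaving i, and all of them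
  -- except (i , i+1) are ≻-above (i , i+1).
  applyA-<-at-source : ∀ {α δ : Mon d} {i j} → toℕ j ≡ suc (toℕ i) → δ i j < α i j →
                       (∀ k l → k Fin.< l → VarGt (k , l) (i , j) → α k l ≡ δ k l) →
                       applyA δ i ℤ.< applyA α i
  applyA-<-at-source {α} {δ} {i} {j} j≡1+i δ<α above =
    sumℤ-< _ _ i (sumℤ-< _ _ j at-ij leaving-i) not-leaving-i
    where
    i<j : i Fin.< j
    i<j = subst (toℕ i <_) (sym j≡1+i) (ℕP.n<1+n (toℕ i))

    at-ij : contribution δ i i j ℤ.< contribution α i i j
    at-ij with i Fin.<? j
    ... | no i≮j = ⊥-elim (i≮j i<j)
    ... | yes _ rewrite incA-source i j =
      subst₂ ℤ._<_ (sym (ℤP.*-identityˡ (+ δ i j))) (sym (ℤP.*-identityˡ (+ α i j))) (ℤ.+<+ δ<α)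

    leaving-i : ∀ b → b ≢ j → contribution δ i i b ≡ contribution α i i b
    leaving-i b b≢j = contribution-cong {δ} {α} {i} λ i<b →
      inj₂ (sym (above i b i<b (inj₂ (refl , ℕP.≤∧≢⇒< (subst (_≤ toℕ b) (sym j≡1+i) i<b)
                                                       (b≢j ∘ FinP.toℕ-injective ∘ sym)))))

    not-leaving-i : ∀ a → a ≢ i → sumℤ (contribution δ i a) ≡ sumℤ (contribution α i a)
    not-leaving-i a a≢i = sumℤ-cong λ b → contribution-cong {δ} {α} {i} λ a<b → entering-i a<b (i Fin.≟ b)
      where
      entering-i : ∀ {b} → a Fin.< b → Dec (i ≡ b) → incA i a b ≡ + 0 ⊎ δ a b ≡ α a b
      entering-i a<b (yes refl) = inj₂ (sym (above a i a<b (inj₁ a<b)))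
      entering-i a<b (no i≢b)   = inj₁ (incA-elsewhere (a≢i ∘ sym) i≢b)

  standard-minimal : ∀ {α δ : Mon d} → Standard α → SameDegree δ α → ¬ (α ≻ δ)
  standard-minimal {α} {δ} std δ~α (i , j , i<j , δ<α , above) =
    ℤP.<-irrefl (δ~α i) (applyA-<-at-source j≡1+i δ<α above)
    where
    j≡1+i : toℕ j ≡ suc (toℕ i)
    j≡1+i = ℕP.≤-antisym (ℕP.≮⇒≥ λ i≁j → ℕP.n≮0 (subst (δ i j <_) (std i j i≁j) δ<α)) i<j

  -- Path monomials

  OnPath : ℕ → ℕ → Fin d → Fin d → Set
  OnPath a b k l = a ≤ toℕ k × suc (toℕ k) ≡ toℕ l × toℕ l ≤ b

  onPath? : ∀ a b k l → Dec (OnPath a b k l)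
  onPath? a b k l = (a ℕP.≤? toℕ k) ×-dec (suc (toℕ k) ℕP.≟ toℕ l) ×-dec (toℕ l ℕP.≤? b)

  -- pathMon i j unfolds to pathUpTo (toℕ i) (toℕ j); the natural-number
  -- endpoint b allows induction on the length of the path.
  pathUpTo : ℕ → ℕ → Mon d
  pathUpTo a b k l = if does (onPath? a b k l) then 1 else 0

  pathUpTo-on : ∀ {a b k l} → OnPath a b k l → pathUpTo a b k l ≡ 1
  pathUpTo-on {a} {b} {k} {l} on = cong (if_then 1 else 0) (dec-true (onPath? a b k l) on)

  pathUpTo-off : ∀ {a b k l} → ¬ OnPath a b k l → pathUpTo a b k l ≡ 0
  pathUpTo-off {a} {b} {k} {l} off = cong (if_then 1 else 0) (dec-false (onPath? a b k l) off)

  pathUpTo-empty : ∀ a k l → pathUpTo a a k l ≡ 0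
  pathUpTo-empty a k l = pathUpTo-off {a} {a} {k} {l} λ (a≤k , k+1≡l , l≤a) →
    ℕP.<-irrefl refl (ℕP.≤-trans (s≤s a≤k) (ℕP.≤-trans (ℕP.≤-reflexive k+1≡l) l≤a))

-- Non-adjacent arcs

shiftArc : ∀ {d} → Fin d × Fin d → Fin (suc d) × Fin (suc d)
shiftArc = Product.map suc suc

arcsFromVertex0 : ∀ e → List (Fin (suc (suc e)) × Fin (suc (suc e)))
arcsFromVertex0 e = map (λ l → zero , suc (suc l)) (allFin e)

nonAdjacentArcs : ∀ d → List (Fin d × Fin d)
nonAdjacentArcs zero          = []
nonAdjacentArcs (suc zero)    = []
nonAdjacentArcs (suc (suc e)) = arcsFromVertex0 e ++ map shiftArc (nonAdjacentArcs (suc e))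

nonAdjacentArcs-nonAdjacent : ∀ d → All (uncurry NonAdjacent) (nonAdjacentArcs d)
nonAdjacentArcs-nonAdjacent zero          = []
nonAdjacentArcs-nonAdjacent (suc zero)    = []
nonAdjacentArcs-nonAdjacent (suc (suc e)) =
  All.++⁺ (All.map⁺ (All.universal (λ _ → s≤s (s≤s z≤n)) (allFin e)))
          (All.map⁺ (All.map s≤s (nonAdjacentArcs-nonAdjacent (suc e))))

∈-nonAdjacentArcs : ∀ {d} {i j : Fin d} → NonAdjacent i j → (i , j) ∈ nonAdjacentArcs d
∈-nonAdjacentArcs {suc (suc e)} {zero}  {suc (suc l)} _         = ∈-++⁺ˡ (∈-map⁺ _ (∈-allFin l))
∈-nonAdjacentArcs {suc (suc e)} {suc i} {suc j}       (s≤s i≁j) =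
  ∈-++⁺ʳ (arcsFromVertex0 e) (∈-map⁺ shiftArc (∈-nonAdjacentArcs i≁j))
∈-nonAdjacentArcs {suc (suc e)} {zero}  {suc zero}    (s≤s ())

nonAdjacentArcs-unique : ∀ d → Unique (nonAdjacentArcs d)
nonAdjacentArcs-unique zero          = []
nonAdjacentArcs-unique (suc zero)    = []
nonAdjacentArcs-unique (suc (suc e)) =
  Unique.++⁺ (Unique.map⁺ (FinP.suc-injective ∘ FinP.suc-injective ∘ ,-injectiveʳ) (Unique.allFin⁺ e))
             (Unique.map⁺ (uncurry (cong₂ _,_) ∘ Product.map FinP.suc-injective FinP.suc-injective ∘ ,-injective)
                          (nonAdjacentArcs-unique (suc e)))
             disjoint
  where
  disjoint : Disjoint (arcsFromVertex0 e) (map shiftArc (nonAdjacentArcs (suc e)))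
  disjoint (from0 , shifted) with ∈-map⁻ _ from0 | ∈-map⁻ _ shifted
  ... | _ , _ , refl | _ , _ , ()

[1+n]C2≡n+nC2 : ∀ n → suc n C 2 ≡ n ℕ.+ n C 2
[1+n]C2≡n+nC2 n = trans (sym (nCk+nC[k+1]≡[n+1]C[k+1] n 1)) (cong (ℕ._+ n C 2) (nC1≡n n))

length-nonAdjacentArcs-suc : ∀ e → length (nonAdjacentArcs (suc e)) ≡ e C 2
length-nonAdjacentArcs-suc zero    = refl
length-nonAdjacentArcs-suc (suc e) = begin
  length (arcsFromVertex0 e ++ map shiftArc (nonAdjacentArcs (suc e)))        ≡⟨ length-++ (arcsFromVertex0 e) ⟩
  length (arcsFromVertex0 e) ℕ.+ length (map shiftArc (nonAdjacentArcs (suc e)))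
    ≡⟨ cong₂ ℕ._+_ (trans (length-map _ (allFin e)) (length-tabulate _))
                   (trans (length-map shiftArc (nonAdjacentArcs (suc e))) (length-nonAdjacentArcs-suc e)) ⟩
  e ℕ.+ e C 2                                                                  ≡⟨ [1+n]C2≡n+nC2 e ⟨
  suc e C 2                                                                    ∎
  where open ≡.≡-Reasoning

length-nonAdjacentArcs : ∀ d → length (nonAdjacentArcs d) ≡ d C 2 ∸ (d ∸ 1)
length-nonAdjacentArcs zero    = refl
length-nonAdjacentArcs (suc e) =
  trans (length-nonAdjacentArcs-suc e)
        (sym (trans (cong (_∸ e) ([1+n]C2≡n+nC2 e)) (ℕP.m+n∸m≡n e (e C 2))))

-- The path binomials

module PathBinomials {c ℓ} (K : Field c ℓ) (d : ℕ) where
  open Field K renaming (refl to ≈-refl; sym to ≈-sym; trans to ≈-trans)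
  open Poly K d
  open Toric K d
  open CommutativeMonoidSolver +-commutativeMonoid using (solve; _⊕_; _⊜_; id)

  varMon-diag : ∀ i j → varMon i j i j ≡ 1
  varMon-diag i j with i Fin.≟ i | j Fin.≟ j
  ... | yes _  | yes _  = refl
  ... | no i≢i | _      = ⊥-elim (i≢i refl)
  ... | yes _  | no j≢j = ⊥-elim (j≢j refl)

  varMon-off : ∀ {i j k l} → ¬ (k ≡ i × l ≡ j) → varMon i j k l ≡ 0
  varMon-off {i} {j} {k} {l} kl≢ij with k Fin.≟ i | l Fin.≟ j
  ... | yes k≡i | yes l≡j = ⊥-elim (kl≢ij (k≡i , l≡j))
  ... | yes _   | no _    = refl
  ... | no _    | _       = refl

  varMon-support : ∀ {i j k l} → varMon i j k l ≢ 0 → k ≡ i × l ≡ j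
  varMon-support {i} {j} {k} {l} nz with (k Fin.≟ i) ×-dec (l Fin.≟ j)
  ... | yes kl≡ij = kl≡ij
  ... | no kl≢ij  = ⊥-elim (nz (varMon-off kl≢ij))

  varMon-∣M⁺ : ∀ {α i j} → 0 < α i j → varMon i j ∣M α
  varMon-∣M⁺ {α} {i} {j} pos k l _ with k Fin.≟ i | l Fin.≟ j
  ... | yes refl | yes refl = pos
  ... | yes _    | no _     = z≤n
  ... | no _     | _        = z≤n

  varMon-∣M⁻ : ∀ {α i j} → i Fin.< j → varMon i j ∣M α → 0 < α i j
  varMon-∣M⁻ {α} {i} {j} i<j x∣α = subst (_≤ α i j) (varMon-diag i j) (x∣α i j i<j)

  applyA-varMon : ∀ {i j} → i Fin.< j → ∀ k → applyA (varMon i j) k ≡ incA k i j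
  applyA-varMon {i} {j} i<j k = begin
    applyA (varMon i j) k                 ≡⟨ sumℤ-single _ i other-row ⟩
    sumℤ (contribution (varMon i j) k i)  ≡⟨ sumℤ-single _ j other-column ⟩
    contribution (varMon i j) k i j       ≡⟨ at-ij ⟩
    incA k i j                            ∎
    where
    open ≡.≡-Reasoning
    other-column : ∀ b → b ≢ j → contribution (varMon i j) k i b ≡ + 0
    other-column b b≢j = contribution-zero {α = varMon i j} {k = k} (varMon-off (b≢j ∘ proj₂))
    other-row : ∀ a → a ≢ i → sumℤ (contribution (varMon i j) k a) ≡ + 0
    other-row a a≢i = sumℤ-zero (contribution (varMon i j) k a) λ b →
      contribution-zero {α = varMon i j} {k = k} (varMon-off (a≢i ∘ proj₁))
    at-ij : contribution (varMon i j) k i j ≡ incA k i j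
    at-ij with i Fin.<? j
    ... | no i≮j = ⊥-elim (i≮j i<j)
    ... | yes _ rewrite varMon-diag i j = ℤP.*-identityʳ (incA k i j)

  pathUpTo-suc : ∀ {a n} {u v : Fin d} → a ≤ n → toℕ u ≡ n → toℕ v ≡ suc n →
                 pathUpTo a (suc n) ≈M (pathUpTo a n ·M varMon u v)
  pathUpTo-suc {a} {n} {u} {v} a≤n u≡n v≡1+n k l _ with onPath? a (suc n) k l
  ... | no off =
    trans (pathUpTo-off off)
          (sym (cong₂ ℕ._+_ (pathUpTo-off {a = a} {b = n} (off ∘ extend)) (varMon-off (off ∘ last-arc))))
    where
    extend : OnPath a n k l → OnPath a (suc n) k l
    extend (a≤k , k+1≡l , l≤n) = a≤k , k+1≡l , ℕP.m≤n⇒m≤1+n l≤n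
    last-arc : k ≡ u × l ≡ v → OnPath a (suc n) k l
    last-arc (refl , refl) =
      subst (a ≤_) (sym u≡n) a≤n , trans (cong suc u≡n) (sym v≡1+n) , ℕP.≤-reflexive v≡1+n
  ... | yes on@(a≤k , k+1≡l , l≤1+n) with toℕ l ℕP.≤? n
  ...   | yes l≤n =
    trans (pathUpTo-on on)
          (sym (cong₂ ℕ._+_ (pathUpTo-on {a = a} {b = n} (a≤k , k+1≡l , l≤n)) (varMon-off {u} {v} {k} {l} not-last)))
    where
    not-last : ¬ (k ≡ u × l ≡ v)
    not-last (_ , l≡v) = ℕP.<-irrefl (trans (cong toℕ l≡v) v≡1+n) (s≤s l≤n)
  ...   | no l≰n  =
    trans (pathUpTo-on on)
          (sym (cong₂ ℕ._+_ (pathUpTo-off {a = a} {b = n} λ (_ , _ , l≤n) → l≰n l≤n)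
                            (subst (λ (k , l) → varMon u v k l ≡ 1) last (varMon-diag u v))))
    where
    l≡1+n : toℕ l ≡ suc n
    l≡1+n = ℕP.≤-antisym l≤1+n (ℕP.≰⇒> l≰n)
    last : (u , v) ≡ (k , l)
    last = cong₂ _,_ (FinP.toℕ-injective (trans u≡n (ℕP.suc-injective (trans (sym l≡1+n) (sym k+1≡l)))))
                     (FinP.toℕ-injective (trans v≡1+n (sym l≡1+n)))

  applyA-pathUpTo : ∀ {i : Fin d} {n} → toℕ i ≤′ n → ∀ v → toℕ v ≡ n →
                    ∀ k → applyA (pathUpTo (toℕ i) n) k ≡ basis i k ℤ.- basis v k
  applyA-pathUpTo {i} ≤′-refl v v≡i k rewrite FinP.toℕ-injective v≡i =
    trans (applyA-zero (pathUpTo-empty (toℕ i)) k) (sym (ℤP.+-inverseʳ (basis i k)))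
  applyA-pathUpTo {i} (≤′-step {n} i≤′n) v v≡1+n k = begin
    applyA (pathUpTo (toℕ i) (suc n)) k
      ≡⟨ applyA-cong (pathUpTo-suc (ℕP.≤′⇒≤ i≤′n) u≡n v≡1+n) k ⟩
    applyA (pathUpTo (toℕ i) n ·M varMon u v) k
      ≡⟨ applyA-· (pathUpTo (toℕ i) n) (varMon u v) k ⟩
    applyA (pathUpTo (toℕ i) n) k ℤ.+ applyA (varMon u v) k
      ≡⟨ cong₂ ℤ._+_ (applyA-pathUpTo i≤′n u u≡n k) column-uv ⟩
    (basis i k ℤ.- basis u k) ℤ.+ (basis u k ℤ.- basis v k)
      ≡⟨ ℤP.+-minus-telescope (basis i k) (basis u k) (basis v k) ⟩
    basis i k ℤ.- basis v k
      ∎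
    where
    open ≡.≡-Reasoning
    n<d : n < d
    n<d = ℕP.<-trans (ℕP.n<1+n n) (subst (_< d) v≡1+n (FinP.toℕ<n v))
    u : Fin d
    u = Fin.fromℕ< n<d
    u≡n : toℕ u ≡ n
    u≡n = FinP.toℕ-fromℕ< n<d
    u<v : u Fin.< v
    u<v = subst₂ _<_ (sym u≡n) (sym v≡1+n) (ℕP.n<1+n n)
    column-uv : applyA (varMon u v) k ≡ basis u k ℤ.- basis v k
    column-uv = trans (applyA-varMon u<v k) (incA-basis {k = k} (FinP.<⇒≢ u<v))

  applyA-pathMon : ∀ {i j} → i Fin.< j → SameDegree (pathMon i j) (varMon i j)
  applyA-pathMon {i} {j} i<j k =
    trans (applyA-pathUpTo (ℕP.≤⇒≤′ (ℕP.<⇒≤ i<j)) j refl k)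
          (sym (trans (applyA-varMon i<j k) (incA-basis {k = k} (FinP.<⇒≢ i<j))))

  pathMon-nonAdjacent : ∀ {i j k l} → NonAdjacent k l → pathMon i j k l ≡ 0
  pathMon-nonAdjacent {i} {j} {k} {l} k≁l =
    pathUpTo-off {a = toℕ i} {b = toℕ j} {k = k} {l = l} λ (_ , k+1≡l , _) → ℕP.<-irrefl k+1≡l k≁l

  varMon≻pathMon : ∀ {i j} → NonAdjacent i j → varMon i j ≻ pathMon i j
  varMon≻pathMon {i} {j} i≁j =
    i , j , NonAdjacent⇒< i≁j ,
    subst₂ _<_ (sym (pathMon-nonAdjacent {i} {j} i≁j)) (sym (varMon-diag i j)) (s≤s z≤n) ,
    above
    where
    above : ∀ k l → k Fin.< l → VarGt (k , l) (i , j) → varMon i j k l ≡ pathMon i j k l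
    above k l _ (inj₁ k<i) =
      trans (varMon-off λ (k≡i , _) → ℕP.<-irrefl (cong toℕ k≡i) k<i)
            (sym (pathUpTo-off {a = toℕ i} {b = toℕ j} {k = k} {l = l} λ (i≤k , _) → ℕP.<⇒≱ k<i i≤k))
    above k l _ (inj₂ (refl , j<l)) =
      trans (varMon-off λ (_ , l≡j) → ℕP.<-irrefl (cong toℕ (sym l≡j)) j<l)
            (sym (pathUpTo-off {a = toℕ i} {b = toℕ j} {k = k} {l = l} λ (_ , _ , l≤j) → ℕP.<⇒≱ j<l l≤j))

  sumOver : ∀ {P : Mon d → Set} → Decidable P → Pol → Carrier
  sumOver P? []            = 0#
  sumOver P? ((a , β) ∷ f) = (if ⌊ P? β ⌋ then a else 0#) + sumOver P? f

  _except_ : ∀ {P : Mon d → Set} → Decidable P → ∀ α → Decidable (λ δ → P δ × ¬ (δ ≈M α))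
  (P? except α) δ = P? δ ×-dec ¬? (δ ≈M? α)

  coeff-∷-≉ : ∀ {a β} f {γ} → ¬ (β ≈M γ) → coeff ((a , β) ∷ f) γ ≈ coeff f γ
  coeff-∷-≉ {β = β} f {γ} β≉γ with β ≈M? γ
  ... | yes β≈γ = ⊥-elim (β≉γ β≈γ)
  ... | no _    = +-identityˡ (coeff f γ)

  coeff-∷-≈ : ∀ {a β} f → coeff ((a , β) ∷ f) β ≈ a + coeff f β
  coeff-∷-≈ {β = β} f with β ≈M? β
  ... | yes _  = ≈-refl
  ... | no β≉β = ⊥-elim (β≉β λ _ _ _ → refl)

  sumOver-++ : ∀ {P} (P? : Decidable P) f g → sumOver P? (f +P g) ≈ sumOver P? f + sumOver P? g
  sumOver-++ P? []            g = ≈-sym (+-identityˡ _)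
  sumOver-++ P? ((a , β) ∷ f) g = ≈-trans (+-congˡ (sumOver-++ P? f g)) (≈-sym (+-assoc _ _ _))

  sumOver-split : ∀ {P α} (P? : Decidable P) → P Respects _≈M_ → P α →
                  ∀ f → sumOver P? f ≈ coeff f α + sumOver (P? except α) f
  sumOver-split P? resp Pα [] = ≈-sym (+-identityˡ 0#)
  sumOver-split {α = α} P? resp Pα ((a , β) ∷ f) with P? β | β ≈M? α | sumOver-split P? resp Pα f
  ... | yes _  | yes _   | IH =
    ≈-trans (+-congˡ IH) (solve 3 (λ a c s → a ⊕ (c ⊕ s) ⊜ (a ⊕ c) ⊕ (id ⊕ s)) ≈-refl a _ _)
  ... | yes _  | no _    | IH =
    ≈-trans (+-congˡ IH) (solve 3 (λ a c s → a ⊕ (c ⊕ s) ⊜ (id ⊕ c) ⊕ (a ⊕ s)) ≈-refl a _ _)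
  ... | no ¬Pβ | yes β≈α | _  = ⊥-elim (¬Pβ (resp (≈M-sym β≈α) Pα))
  ... | no _   | no _    | IH =
    ≈-trans (+-congˡ IH) (solve 2 (λ c s → id ⊕ (c ⊕ s) ⊜ (id ⊕ c) ⊕ (id ⊕ s)) ≈-refl _ _)

  -- Equality in K is not decidable, so the coefficients are only known to vanish
  -- up to double negation; that suffices, since the lemma only serves to reach ⊥.
  sumOver-vanish : ∀ {P} (P? : Decidable P) → P Respects _≈M_ → ∀ f →
                   (∀ δ → P δ → DoubleNegation (coeff f δ ≈ 0#)) → DoubleNegation (sumOver P? f ≈ 0#)
  sumOver-vanish P? resp [] _ = λ ¬0≈0 → ¬0≈0 ≈-refl
  sumOver-vanish {P} P? resp ((a , β) ∷ f) vanishes with P? β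
  ... | no ¬Pβ =
    ¬¬-map (≈-trans (+-identityˡ _)) (sumOver-vanish P? resp f λ δ Pδ →
      ¬¬-map (≈-trans (≈-sym (coeff-∷-≉ f λ β≈δ → ¬Pβ (resp (≈M-sym β≈δ) Pδ)))) (vanishes δ Pδ))
  ... | yes Pβ =
    zipWith sum≈0 (vanishes β Pβ) (sumOver-vanish (P? except β) resp∖β f λ δ (Pδ , δ≉β) →
      ¬¬-map (≈-trans (≈-sym (coeff-∷-≉ f (δ≉β ∘ ≈M-sym)))) (vanishes δ Pδ))
    where
    open RawMonad ¬¬-Monad using (zipWith)
    resp∖β : (λ δ → P δ × ¬ (δ ≈M β)) Respects _≈M_
    resp∖β γ≈δ (Pγ , γ≉β) = resp γ≈δ Pγ , λ δ≈β → γ≉β (≈M-trans γ≈δ δ≈β)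
    sum≈0 : coeff ((a , β) ∷ f) β ≈ 0# → sumOver (P? except β) f ≈ 0# → a + sumOver P? f ≈ 0#
    sum≈0 head≈0 rest≈0 = begin
      a + sumOver P? f                           ≈⟨ +-congˡ (sumOver-split P? resp Pβ f) ⟩
      a + (coeff f β + sumOver (P? except β) f)  ≈⟨ +-assoc a _ _ ⟨
      (a + coeff f β) + sumOver (P? except β) f  ≈⟨ +-cong (≈-trans (≈-sym (coeff-∷-≈ f)) head≈0) rest≈0 ⟩
      0# + 0#                                    ≈⟨ +-identityˡ 0# ⟩
      0#                                         ∎
      where open ≈-Reasoning setoid

  sumOver-*binom : ∀ {P} (P? : Decidable P) → P Respects SameDegree →
                   ∀ {u v} → SameDegree u v → ∀ h → sumOver P? (h *P binom u v) ≈ 0#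
  sumOver-*binom P? resp u~v [] = ≈-refl
  sumOver-*binom P? resp {u} {v} u~v ((a , α) ∷ h) with P? (α ·M u) | P? (α ·M v)
  ... | yes _   | yes _   = ≈-trans (≈-sym (+-assoc _ _ _)) (≈-trans (+-cong a-a≈0 rest≈0) (+-identityˡ 0#))
    where
    a-a≈0 : a * 1# + a * - 1# ≈ 0#
    a-a≈0 = ≈-trans (≈-sym (distribˡ a 1# (- 1#))) (≈-trans (*-congˡ (-‿inverseʳ 1#)) (zeroʳ a))
    rest≈0 : sumOver P? (h *P binom u v) ≈ 0#
    rest≈0 = sumOver-*binom P? resp u~v h
  ... | yes Pαu | no ¬Pαv = ⊥-elim (¬Pαv (resp (SameDegree-·ˡ α u~v) Pαu))
  ... | no ¬Pαu | yes Pαv = ⊥-elim (¬Pαu (resp (sym ∘ SameDegree-·ˡ α u~v) Pαv))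
  ... | no _    | no _    = ≈-trans (+-identityˡ _) (≈-trans (+-identityˡ _) (sumOver-*binom P? resp u~v h))

  combination : List (Pol × Gen) → Pol
  combination hs = sumP (map (λ ((h , u , v , _) : Pol × Gen) → h *P binom u v) hs)

  sumOver-combination : ∀ {P} (P? : Decidable P) → P Respects SameDegree →
                        ∀ hs → sumOver P? (combination hs) ≈ 0#
  sumOver-combination P? resp []                      = ≈-refl
  sumOver-combination P? resp ((h , u , v , u~v) ∷ hs) =
    ≈-trans (sumOver-++ P? (h *P binom u v) (combination hs))
            (≈-trans (+-cong (sumOver-*binom P? resp u~v h) (sumOver-combination P? resp hs)) (+-identityˡ 0#))

  InIA-isolated-coeff-vanishes : ∀ {P f α} (P? : Decidable P) → P Respects SameDegree → InIA f → P α →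
                        (∀ δ → P δ → ¬ (δ ≈M α) → DoubleNegation (coeff f δ ≈ 0#)) →
                        DoubleNegation (coeff f α ≈ 0#)
  InIA-isolated-coeff-vanishes {P} {f} {α} P? resp (hs , f≈F) Pα others =
    ¬¬-map coeff≈0 (sumOver-vanish (P? except α) resp∖α F λ δ (Pδ , δ≉α) →
                      ¬¬-map (≈-trans (≈-sym (f≈F δ))) (others δ Pδ δ≉α))
    where
    F : Pol
    F = combination hs
    resp≈M : P Respects _≈M_
    resp≈M = resp ∘ applyA-cong
    resp∖α : (λ δ → P δ × ¬ (δ ≈M α)) Respects _≈M_
    resp∖α γ≈δ (Pγ , γ≉α) = resp≈M γ≈δ Pγ , λ δ≈α → γ≉α (≈M-trans γ≈δ δ≈α)
    coeff≈0 : sumOver (P? except α) F ≈ 0# → coeff f α ≈ 0#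
    coeff≈0 rest≈0 = begin
      coeff f α                            ≈⟨ f≈F α ⟩
      coeff F α                            ≈⟨ +-identityʳ _ ⟨
      coeff F α + 0#                       ≈⟨ +-congˡ rest≈0 ⟨
      coeff F α + sumOver (P? except α) F  ≈⟨ sumOver-split P? resp≈M Pα F ⟨
      sumOver P? F                         ≈⟨ sumOver-combination P? resp hs ⟩
      0#                                   ∎
      where open ≈-Reasoning setoid

  standard-not-leading : ∀ {f α} → InIA f → LM f α → ¬ Standard α
  standard-not-leading {f} {α} f∈I (α-nz , α-max) std =
    InIA-isolated-coeff-vanishes {f = f} (λ δ → sameDegree? δ α) (λ β~γ β~α k → trans (sym (β~γ k)) (β~α k))
                        f∈I (λ _ → refl) below-α α-nz
    where
    below-α : ∀ δ → SameDegree δ α → ¬ (δ ≈M α) → DoubleNegation (coeff f δ ≈ 0#)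
    below-α δ δ~α δ≉α δ-nz with α-max δ δ-nz
    ... | inj₁ δ≈α = δ≉α δ≈α
    ... | inj₂ α≻δ = standard-minimal std δ~α α≻δ

  coeff-binom-support : ∀ {u v γ} → ¬ (coeff (binom u v) γ ≈ 0#) → u ≈M γ ⊎ v ≈M γ
  coeff-binom-support {u} {v} {γ} nz with u ≈M? γ | v ≈M? γ
  ... | yes u≈γ | _       = inj₁ u≈γ
  ... | no _    | yes v≈γ = inj₂ v≈γ
  ... | no _    | no _    = ⊥-elim (nz (≈-trans (+-identityˡ _) (+-identityˡ 0#)))

  coeff-binom-lead : ∀ {u v} → ¬ (v ≈M u) → coeff (binom u v) u ≈ 1#
  coeff-binom-lead {u} {v} v≉u with u ≈M? u | v ≈M? u
  ... | yes _  | no _    = ≈-trans (+-congˡ (+-identityˡ 0#)) (+-identityʳ 1#)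
  ... | no u≉u | _       = ⊥-elim (u≉u λ _ _ _ → refl)
  ... | yes _  | yes v≈u = ⊥-elim (v≉u v≈u)

  LM-binom : ∀ {u v} → u ≻ v → LM (binom u v) u
  LM-binom u≻v = (λ lead≈0 → 1≉0 (≈-trans (≈-sym (coeff-binom-lead (≻⇒≉M u≻v))) lead≈0)) ,
                 λ γ nz → Sum.map ≈M-sym (≻-respʳ u≻v) (coeff-binom-support nz)

  LM-unique : ∀ {f α β} → LM f α → LM f β → α ≈M β
  LM-unique (α-nz , α-max) (β-nz , β-max) with α-max _ β-nz | β-max _ α-nz
  ... | inj₁ β≈α | _        = ≈M-sym β≈α
  ... | inj₂ _   | inj₁ α≈β = α≈β
  ... | inj₂ α≻β | inj₂ β≻α = ⊥-elim (≻-asym α≻β β≻α)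

  pathBinom-InIA : ∀ {i j} → i Fin.< j → InIA (pathBinom i j)
  pathBinom-InIA {i} {j} i<j =
    (one , varMon i j , pathMon i j , sym ∘ applyA-pathMon i<j) ∷ [] ,
    λ γ → +-cong (if-cong ⌊ varMon i j ≈M? γ ⌋ (*-identityˡ 1#))
                 (+-congʳ (if-cong ⌊ pathMon i j ≈M? γ ⌋ (*-identityˡ (- 1#))))
    where
    one : Pol
    one = (1# , λ _ _ → 0) ∷ []
    if-cong : ∀ b {x y} → x ≈ y → (if b then y else 0#) ≈ (if b then x else 0#)
    if-cong true  x≈y = ≈-sym x≈y
    if-cong false _   = ≈-refl

  LM-pathBinom : ∀ {i j} → NonAdjacent i j → LM (pathBinom i j) (varMon i j)
  LM-pathBinom i≁j = LM-binom (varMon≻pathMon i≁j)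

  pathBinom-divisor : ∀ {i j i′ j′ γ} → NonAdjacent i j → NonAdjacent i′ j′ →
                      ¬ (coeff (pathBinom i j) γ ≈ 0#) → varMon i′ j′ ∣M γ → (i , j) ≡ (i′ , j′)
  pathBinom-divisor {i} {j} {i′} {j′} {γ} i≁j i′≁j′ nz x∣γ with coeff-binom-support nz
  ... | inj₁ var≈γ  = let i′≡i , j′≡j = varMon-support (nonzero-at-i′j′ (var≈γ i′ j′ i′<j′)) in
                      cong₂ _,_ (sym i′≡i) (sym j′≡j)
    where
    i′<j′ : i′ Fin.< j′
    i′<j′ = NonAdjacent⇒< i′≁j′
    nonzero-at-i′j′ : ∀ {n} → n ≡ γ i′ j′ → n ≢ 0
    nonzero-at-i′j′ n≡γ n≡0 = ℕP.<-irrefl (trans (sym n≡0) n≡γ) (varMon-∣M⁻ i′<j′ x∣γ)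
  ... | inj₂ path≈γ =
    ⊥-elim (ℕP.<-irrefl (trans (sym (pathMon-nonAdjacent {i} {j} i′≁j′)) (path≈γ i′ j′ i′<j′))
                        (varMon-∣M⁻ i′<j′ x∣γ))
    where
    i′<j′ : i′ Fin.< j′
    i′<j′ = NonAdjacent⇒< i′≁j′

  pathBinom-injective : ∀ {i j i′ j′} → NonAdjacent i j → NonAdjacent i′ j′ →
                        pathBinom i j ≈P pathBinom i′ j′ → (i , j) ≡ (i′ , j′)
  pathBinom-injective i≁j i′≁j′ same =
    pathBinom-divisor i≁j i′≁j′ (λ c≈0 → proj₁ (LM-pathBinom i′≁j′) (≈-trans (≈-sym (same _)) c≈0))
                      (λ _ _ _ → ℕP.≤-refl)

  pathBinomials : List Pol
  pathBinomials = map (uncurry pathBinom) (nonAdjacentArcs d)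

  ∈-pathBinomials⁺ : ∀ {i j} → NonAdjacent i j → pathBinom i j ∈ pathBinomials
  ∈-pathBinomials⁺ i≁j = ∈-map⁺ (uncurry pathBinom) (∈-nonAdjacentArcs i≁j)

  ∈-pathBinomials⁻ : ∀ {g} → g ∈ pathBinomials → ∃[ i ] ∃[ j ] (NonAdjacent i j × g ≡ pathBinom i j)
  ∈-pathBinomials⁻ g∈ with ∈-map⁻ (uncurry pathBinom) g∈
  ... | (i , j) , ij∈ , g≡ = i , j , All.lookup (nonAdjacentArcs-nonAdjacent d) ij∈ , g≡

  pathBinomials-sound : ∀ g → g ∈ pathBinomials → ∃[ i ] ∃[ j ] (NonAdjacent i j × g ≈P pathBinom i j)
  pathBinomials-sound g g∈ with ∈-pathBinomials⁻ g∈
  ... | i , j , i≁j , refl = i , j , i≁j , λ _ → ≈-refl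

  pathBinomials-complete : ∀ i j → NonAdjacent i j → ∃[ g ] ((g ∈ pathBinomials) × (g ≈P pathBinom i j))
  pathBinomials-complete i j i≁j = pathBinom i j , ∈-pathBinomials⁺ i≁j , λ _ → ≈-refl

  pathBinomials-distinct : AllPairs (λ g h → ¬ (g ≈P h)) pathBinomials
  pathBinomials-distinct =
    AllPairs-map⁺-within (λ i≁j i′≁j′ ij≢i′j′ → ij≢i′j′ ∘ pathBinom-injective i≁j i′≁j′)
                         (nonAdjacentArcs-nonAdjacent d) (nonAdjacentArcs-unique d)

  pathBinomials-unique : Unique pathBinomials
  pathBinomials-unique = AllPairs.map (λ { g≉h refl → g≉h λ _ → ≈-refl }) pathBinomials-distinct

  length-pathBinomials : length pathBinomials ≡ d C 2 ∸ (d ∸ 1)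
  length-pathBinomials = trans (length-map (uncurry pathBinom) (nonAdjacentArcs d)) (length-nonAdjacentArcs d)

  pathBinomials-reduced : ∀ {g h β γ} → g ∈ pathBinomials → h ∈ pathBinomials →
                          LM h β → ¬ (coeff g γ ≈ 0#) → β ∣M γ → g ≡ h
  pathBinomials-reduced {γ = γ} g∈ h∈ β-lead nz β∣γ with ∈-pathBinomials⁻ g∈ | ∈-pathBinomials⁻ h∈
  ... | i , j , i≁j , refl | i′ , j′ , i′≁j′ , refl =
    cong (uncurry pathBinom) (pathBinom-divisor i≁j i′≁j′ nz x∣γ)
    where
    x∣γ : varMon i′ j′ ∣M γ
    x∣γ k l k<l = subst (_≤ γ k l) (LM-unique {f = pathBinom i′ j′} β-lead (LM-pathBinom i′≁j′) k l k<l)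
                        (β∣γ k l k<l)

  pathBinomials-isReducedGB : IsReducedGB InIA pathBinomials
  pathBinomials-isReducedGB = record
    { ⊆I      = ⊆I
    ; monic   = monic
    ; leading = leading
    ; reduced = λ p q p≢q β β-lead γ nz β∣γ → p≢q (lookup-injective pathBinomials-unique
                  (pathBinomials-reduced (∈-lookup p) (∈-lookup q) β-lead nz β∣γ))
    }
    where
    ⊆I : ∀ g → g ∈ pathBinomials → InIA g
    ⊆I g g∈ with ∈-pathBinomials⁻ g∈
    ... | i , j , i≁j , refl = pathBinom-InIA (NonAdjacent⇒< i≁j)

    monic : ∀ g → g ∈ pathBinomials → ∃[ α ] (LM g α × (coeff g α ≈ 1#))
    monic g g∈ with ∈-pathBinomials⁻ g∈
    ... | i , j , i≁j , refl = varMon i j , LM-pathBinom i≁j , coeff-binom-lead (≻⇒≉M (varMon≻pathMon i≁j))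

    leading : ∀ f → InIA f → ¬ IsZero f → ∀ α → LM f α →
              ∃[ g ] ∃[ β ] ((g ∈ pathBinomials) × LM g β × (β ∣M α))
    leading f f∈I _ α α-lead with standard-or-nonAdjacentFactor α
    ... | inj₁ std                 = ⊥-elim (standard-not-leading {f = f} f∈I α-lead std)
    ... | inj₂ (i , j , i≁j , pos) =
      pathBinom i j , varMon i j , ∈-pathBinomials⁺ i≁j , LM-pathBinom i≁j , varMon-∣M⁺ pos

proposition4p9 : ∀ {c ℓ : Level} (K : Field c ℓ) (d : ℕ) →
    let open Poly K d
        open Toric K d
    in Σ (List Pol) λ G →
         IsReducedGB InIA G
       × (∀ g → g ∈ G → ∃[ i ] ∃[ j ] ((suc (toℕ i) < toℕ j) × (g ≈P pathBinom i j)))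
       × (∀ (i j : Fin d) → suc (toℕ i) < toℕ j → ∃[ g ] ((g ∈ G) × (g ≈P pathBinom i j)))
       × AllPairs (λ g h → ¬ (g ≈P h)) G
       × (length G ≡ (d C 2) ∸ (d ∸ 1))
proposition4p9 K d =
  pathBinomials , pathBinomials-isReducedGB , pathBinomials-sound , pathBinomials-complete ,
  pathBinomials-distinct , length-pathBinomials
  where open PathBinomials K d
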